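{- Let $G=(V,E^+\cup N,w)$ with $w(e)\ge0$ for all $e\in E^+$, let $r\ge1$ be an integer, and let $H=(V_H,E_H,w_H)$ be the hop-reduction graph of $G$ with parameter $r$. Let $p$ be any $h$-hop $s$-to-$v$ path in $G$, for any $s,v\in V$. Then there exist a layer $j$ with $0\le j\le r$ (and $v_j\in V_H$), an integer $h_H\ge 0$, and an $h_H$-hop $s_0$-to-$v_j$ path $p_H$ in $H$ such that (1) $w_H(p_H)=w(p)+\delta_0(s)-\delta_j(v)$, and (2) $r h_H+j\le h$.
   Context: $G=(V,E^+\cup N,w)$ is a directed graph with real weights whose edge set is partitioned into nonnegative edges $E^+$ and negative edges $N$. Paths need not be simple; a $j$-hop path in $G$ contains at most $j$ edges of $N$ (with multiplicity); $\mathrm{dist}^j_G(u,v)$ is the minimum weight of a $j$-hop $u$-to-$v$ path ($\infty$ if none). In $H$, an $h$-hop path is one containing at most $h$ edges of negative weight (under $w_H$). Define $\delta_j(v)=\min_{u\in V}\mathrm{dist}^j_G(u,v)$ for $0\le j\le r$, and $R=\{v:\delta_r(v)<0\}$. Hop-reduction graph $H$: $V_H=V\cup\{v_j: v\in R, 1\le j\le r\}$, where $v_0$ denotes $v\in V$. $E_H$ consists of: for $(u,v)\in E^+$: $(u_j,v_j)$ for $0\le j\le r$ if $u,v\in R$; $(u_j,v_0)$ for $0\le j\le r$ if $u\in R,v\notin R$; $(u_0,v_0)$ if $u\notin R$. For $(u,v)\in N$: $(u_j,v_{j+1})$ for $0\le j<r$ if $u,v\in R$; $(u_j,v_0)$ for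 $0\le j<r$ if $u\in R,v\notin R$; $(u_0,v_1)$ if $u\notin R,v\in R$; $(u_0,v_0)$ if $u,v\notin R$. For each $u\in R$: self edges $(u_0,u_1),\dots,(u_{r-1},u_r),(u_r,u_0)$. Weights: $w_H(u_i,v_j)=w(u,v)+\delta_i(u)-\delta_j(v)$, with $w(u,u)=0$.
   Formalization: The edge weights of $G$ are rational instead of real, so the values $\delta_j(v)$ and the weights $w_H$ of the hop-reduction graph are rational as well. -}

module Defs where

open import Data.Nat using (ℕ; zero; suc; _≤_; _<_)
open import Data.Fin using (Fin)
open import Data.Bool using (Bool; true; false; if_then_else_)
open import Data.List using (List)
open import Data.List.Membership.Propositional using (_∈_)
open import Data.Product using (_×_; _,_; Σ)
open import Data.Sum using (_⊎_)
open import Relation.Binary.PropositionalEquality using (_≡_)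
open import Relation.Nullary using (¬_)
open import Relation.Nullary.Decidable using (isYes)
open import Data.Rational using (ℚ; 0ℚ; _+_; _-_)
import Data.Rational as Q
open import Data.Rational.Properties using (_<?_)

-- A directed edge of G on vertex set Fin n.
-- neg = true  : the edge belongs to N
-- neg = false : the edge belongs to E⁺
record Edge (n : ℕ) : Set where
  constructor edge
  field
    src : Fin n
    tgt : Fin n
    wt  : ℚ
    neg : Bool
open Edge public

-- The graph G is given by n (V = Fin n) and a list es of edges
-- (E⁺ ∪ N, partitioned by the field neg).

data Walk {n : ℕ} (es : List (Edge n)) : Fin n → Fin n → Set where
  []  : ∀ {u} → Walk es u u
  _∷_ : ∀ {e v} → e ∈ es → Walk es (tgt e) v → Walk es (src e) v

weight : ∀ {n} {es : List (Edge n)} {u v} → Walk es u v → ℚ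
weight [] = 0ℚ
weight (_∷_ {e = e} _ p) = wt e + weight p

hops : ∀ {n} {es : List (Edge n)} {u v} → Walk es u v → ℕ
hops [] = 0
hops (_∷_ {e = e} _ p) = if neg e then suc (hops p) else hops p

NonnegE⁺ : ∀ {n} → List (Edge n) → Set
NonnegE⁺ es = ∀ e → e ∈ es → neg e ≡ false → 0ℚ Q.≤ wt e

-- δ is the function δ_j(v) = min_u dist^j_G(u,v) for 0 ≤ j ≤ r:
-- the minimum is attained by some j-hop walk ending at v, and is a
-- lower bound for the weights of all j-hop walks ending at v.
IsDelta : ∀ {n} → List (Edge n) → ℕ → (ℕ → Fin n → ℚ) → Set
IsDelta {n} es r δ = ∀ j v → j ≤ r →
    (Σ (Fin n) λ u → Σ (Walk es u v) λ p → hops p ≤ j × weight p ≡ δ j v)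
  × (∀ u (p : Walk es u v) → hops p ≤ j → δ j v Q.≤ weight p)

module HopReduction {n : ℕ} (es : List (Edge n)) (r : ℕ) (δ : ℕ → Fin n → ℚ) where

  InR : Fin n → Set
  InR v = δ r v Q.< 0ℚ

  -- Vertices of H are pairs (v , j) standing for v_j; (v , 0) is v itself.
  -- Membership in V_H:
  InVH : Fin n × ℕ → Set
  InVH (v , j) = j ≤ r × (j ≡ 0 ⊎ InR v)

  data HEdge : Fin n × ℕ → Fin n × ℕ → Set where
    pos-RR   : ∀ {e} j → e ∈ es → neg e ≡ false → InR (src e) → InR (tgt e) → j ≤ r →
               HEdge (src e , j) (tgt e , j)
    pos-RnR  : ∀ {e} j → e ∈ es → neg e ≡ false → InR (src e) → ¬ InR (tgt e) → j ≤ r →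
               HEdge (src e , j) (tgt e , 0)
    pos-nR   : ∀ {e} → e ∈ es → neg e ≡ false → ¬ InR (src e) →
               HEdge (src e , 0) (tgt e , 0)
    neg-RR   : ∀ {e} j → e ∈ es → neg e ≡ true → InR (src e) → InR (tgt e) → j < r →
               HEdge (src e , j) (tgt e , suc j)
    neg-RnR  : ∀ {e} j → e ∈ es → neg e ≡ true → InR (src e) → ¬ InR (tgt e) → j < r →
               HEdge (src e , j) (tgt e , 0)
    neg-nRR  : ∀ {e} → e ∈ es → neg e ≡ true → ¬ InR (src e) → InR (tgt e) →
               HEdge (src e , 0) (tgt e , 1)
    neg-nRnR : ∀ {e} → e ∈ es → neg e ≡ true → ¬ InR (src e) → ¬ InR (tgt e) →
               HEdge (src e , 0) (tgt e , 0)
    self-up  : ∀ u j → InR u → j < r → HEdge (u , j) (u , suc j)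
    self-back : ∀ u → InR u → HEdge (u , r) (u , 0)

  baseWt : ∀ {a b} → HEdge a b → ℚ
  baseWt (pos-RR {e} _ _ _ _ _ _)  = wt e
  baseWt (pos-RnR {e} _ _ _ _ _ _) = wt e
  baseWt (pos-nR {e} _ _ _)        = wt e
  baseWt (neg-RR {e} _ _ _ _ _ _)  = wt e
  baseWt (neg-RnR {e} _ _ _ _ _ _) = wt e
  baseWt (neg-nRR {e} _ _ _ _)     = wt e
  baseWt (neg-nRnR {e} _ _ _ _)    = wt e
  baseWt (self-up _ _ _ _)         = 0ℚ
  baseWt (self-back _ _)           = 0ℚ

  wH : ∀ {u i v j} → HEdge (u , i) (v , j) → ℚ
  wH {u} {i} {v} {j} e = baseWt e + δ i u - δ j v

  data HWalk : Fin n × ℕ → Fin n × ℕ → Set where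
    []  : ∀ {a} → HWalk a a
    _∷_ : ∀ {a b c} → HEdge a b → HWalk b c → HWalk a c

  weightH : ∀ {a b} → HWalk a b → ℚ
  weightH [] = 0ℚ
  weightH (_∷_ {u , i} {v , j} e p) = wH e + weightH p

  hopsH : ∀ {a b} → HWalk a b → ℕ
  hopsH [] = 0
  hopsH (_∷_ {u , i} {v , j} e p) =
    if isYes (wH e <? 0ℚ) then suc (hopsH p) else hopsH p

{-# OPTIONS --safe #-}
-- Follow p through H: the layer counts the negative edges taken since the last visit to
-- layer 0, it falls back to 0 whenever the walk leaves R, and at the top layer r the return
-- edge u_r → u_0 is inserted before the next negative edge.  The potentials δ telescope
-- along any H-walk, which gives the weight identity.  Since δ_k′(v) ≤ w(u,v) + δ_k(u)
-- whenever k plus the hop count of (u,v) is at most k′ ≤ r, every edge of H except the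
-- return edges has nonnegative w_H; so p_H has at most as many hops as return edges, and
-- each return edge is paid for by r negative edges of p.
module Submission where

open import Defs
open import Data.Nat using (ℕ; _≤_; _+_; _*_)
open import Data.Fin using (Fin)
open import Data.List using (List)
open import Data.Product using (_×_; _,_; Σ)
open import Relation.Binary.PropositionalEquality using (_≡_)
open import Data.Rational using (ℚ) renaming (_+_ to _+ℚ_; _-_ to _-ℚ_)

open import Data.Bool using (Bool; true; false; if_then_else_)
open import Data.Nat using (suc; _<_; z≤n; s≤s)
open import Data.Nat.Properties
  using (≤-refl; <⇒≤; ≤-reflexive; ≤-trans; m≤m+n; m≤n⇒m≤1+n; m≤n⇒m<n∨m≡n;
         +-assoc; +-comm; +-identityʳ; *-zeroʳ; *-suc; *-distribˡ-+; +-monoˡ-≤; +-monoʳ-≤;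
         module ≤-Reasoning)
open import Data.Rational using (0ℚ; -_)
import Data.Rational as ℚ
import Data.Rational.Properties as ℚₚ
open import Data.Rational.Solver using (module +-*-Solver)
open import Data.List.Membership.Propositional using (_∈_)
open import Data.Product using (proj₁; proj₂)
open import Data.Sum using (inj₁; inj₂)
open import Data.Empty using (⊥-elim)
open import Relation.Nullary using (¬_; Dec; yes; no)
open import Relation.Binary.PropositionalEquality
  using (refl; sym; trans; cong; cong₂; subst; module ≡-Reasoning)

p≤q⇒0≤q-p : ∀ {p q} → p ℚ.≤ q → 0ℚ ℚ.≤ q -ℚ p
p≤q⇒0≤q-p {p} {q} p≤q =
  subst (ℚ._≤ q -ℚ p) (ℚₚ.+-inverseʳ p) (ℚₚ.+-monoˡ-≤ (- p) p≤q)

module WalkProperties {n : ℕ} (es : List (Edge n)) where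

  infixl 5 _∷ʳ_

  _∷ʳ_ : ∀ {u e} → Walk es u (src e) → e ∈ es → Walk es u (tgt e)
  []       ∷ʳ m = m ∷ []
  (m′ ∷ p) ∷ʳ m = m′ ∷ (p ∷ʳ m)

  weight-∷ʳ : ∀ {u e} (p : Walk es u (src e)) (m : e ∈ es) →
              weight (p ∷ʳ m) ≡ weight p +ℚ wt e
  weight-∷ʳ {e = e} [] m = trans (ℚₚ.+-identityʳ (wt e)) (sym (ℚₚ.+-identityˡ (wt e)))
  weight-∷ʳ (_∷_ {e = e′} m′ p) m =
    trans (cong (wt e′ +ℚ_) (weight-∷ʳ p m)) (sym (ℚₚ.+-assoc (wt e′) (weight p) _))

  hops-∷ʳ : ∀ {u e} (p : Walk es u (src e)) (m : e ∈ es) →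
            hops (p ∷ʳ m) ≡ hops p + hops (m ∷ [])
  hops-∷ʳ [] m = refl
  hops-∷ʳ (_∷_ {e = e′} m′ p) m with neg e′
  ... | true  = cong suc (hops-∷ʳ p m)
  ... | false = hops-∷ʳ p m

  hops-∷ : ∀ {e v} (m : e ∈ es) (q : Walk es (tgt e) v) → hops (m ∷ q) ≡ hops (m ∷ []) + hops q
  hops-∷ {e} m q with neg e
  ... | true  = refl
  ... | false = refl

  weight-nonneg : NonnegE⁺ es → ∀ {u v} (p : Walk es u v) → hops p ≤ 0 → 0ℚ ℚ.≤ weight p
  weight-nonneg nonneg [] _ = ℚₚ.≤-refl
  weight-nonneg nonneg (_∷_ {e = e} m p) hp with neg e in eq
  weight-nonneg nonneg (_∷_ {e = e} m p) () | true
  ... | false = subst (ℚ._≤ wt e +ℚ weight p) (ℚₚ.+-identityˡ 0ℚ)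
                  (ℚₚ.+-mono-≤ (nonneg e m eq) (weight-nonneg nonneg p hp))

module HWalkProperties {n : ℕ} (es : List (Edge n)) (r : ℕ) (δ : ℕ → Fin n → ℚ) where
  open HopReduction es r δ

  isReturn : ∀ {a b} → HEdge a b → Bool
  isReturn (self-back _ _) = true
  isReturn _               = false

  returnEdges : ∀ {a b} → HWalk a b → ℕ
  returnEdges []       = 0
  returnEdges (e ∷ p) = if isReturn e then suc (returnEdges p) else returnEdges p

  baseWeightH : ∀ {a b} → HWalk a b → ℚ
  baseWeightH []       = 0ℚ
  baseWeightH (e ∷ p) = baseWt e +ℚ baseWeightH p

  infixr 5 _++ᴴ_

  _++ᴴ_ : ∀ {a b c} → HWalk a b → HWalk b c → HWalk a c
  []      ++ᴴ q = q
  (e ∷ p) ++ᴴ q = e ∷ (p ++ᴴ q)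

  returnEdges-++ : ∀ {a b c} (p : HWalk a b) (q : HWalk b c) →
                   returnEdges (p ++ᴴ q) ≡ returnEdges p + returnEdges q
  returnEdges-++ []      q = refl
  returnEdges-++ (e ∷ p) q with isReturn e
  ... | true  = cong suc (returnEdges-++ p q)
  ... | false = returnEdges-++ p q

  baseWeightH-++ : ∀ {a b c} (p : HWalk a b) (q : HWalk b c) →
                   baseWeightH (p ++ᴴ q) ≡ baseWeightH p +ℚ baseWeightH q
  baseWeightH-++ []      q = sym (ℚₚ.+-identityˡ _)
  baseWeightH-++ (e ∷ p) q =
    trans (cong (baseWt e +ℚ_) (baseWeightH-++ p q)) (sym (ℚₚ.+-assoc (baseWt e) _ _))

  weightH-telescopes : ∀ {u i x j} (p : HWalk (u , i) (x , j)) →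
                       weightH p ≡ baseWeightH p +ℚ δ i u -ℚ δ j x
  weightH-telescopes {u} {i} [] =
    sym (trans (cong (_-ℚ δ i u) (ℚₚ.+-identityˡ (δ i u))) (ℚₚ.+-inverseʳ (δ i u)))
  weightH-telescopes {u} {i} {x} {j} (_∷_ {b = y , k} e p) = begin
    (baseWt e +ℚ δ i u -ℚ δ k y) +ℚ weightH p
      ≡⟨ cong ((baseWt e +ℚ δ i u -ℚ δ k y) +ℚ_) (weightH-telescopes p) ⟩
    (baseWt e +ℚ δ i u -ℚ δ k y) +ℚ (baseWeightH p +ℚ δ k y -ℚ δ j x)
      ≡⟨ solve 5 (λ b B di dk dj → (b :+ di :- dk) :+ (B :+ dk :- dj) := (b :+ B) :+ di :- dj)
               refl (baseWt e) (baseWeightH p) (δ i u) (δ k y) (δ j x) ⟩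
    (baseWt e +ℚ baseWeightH p) +ℚ δ i u -ℚ δ j x ∎
    where open ≡-Reasoning
          open +-*-Solver

module Lifting {n : ℕ} (es : List (Edge n)) (nonneg : NonnegE⁺ es)
               (r : ℕ) (r≥1 : 1 ≤ r) (δ : ℕ → Fin n → ℚ) (isDelta : IsDelta es r δ) where
  open WalkProperties es
  open HopReduction es r δ
  open HWalkProperties es r δ

  δ-extend : ∀ {e k k′} (m : e ∈ es) → k + hops (m ∷ []) ≤ k′ → k′ ≤ r →
             δ k′ (tgt e) ℚ.≤ wt e +ℚ δ k (src e)
  δ-extend {e} {k} {k′} m k+1≤k′ k′≤r
    with proj₁ (isDelta k (src e) (≤-trans (m≤m+n k _) (≤-trans k+1≤k′ k′≤r)))
  ... | u , p , hp≤k , wp≡δ =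
    subst (δ k′ (tgt e) ℚ.≤_) weight≡ (proj₂ (isDelta k′ (tgt e) k′≤r) u (p ∷ʳ m) hops≤)
    where
    weight≡ : weight (p ∷ʳ m) ≡ wt e +ℚ δ k (src e)
    weight≡ = trans (weight-∷ʳ p m) (trans (cong (_+ℚ wt e) wp≡δ) (ℚₚ.+-comm _ (wt e)))
    hops≤ : hops (p ∷ʳ m) ≤ k′
    hops≤ = subst (_≤ k′) (sym (hops-∷ʳ p m)) (≤-trans (+-monoˡ-≤ _ hp≤k) k+1≤k′)

  δ-extend⁺ : ∀ {e k k′} (m : e ∈ es) → neg e ≡ false → k ≤ k′ → k′ ≤ r →
              δ k′ (tgt e) ℚ.≤ wt e +ℚ δ k (src e)
  δ-extend⁺ {k = k} {k′} m eq k≤k′ =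
    δ-extend m (subst (λ b → k + (if b then 1 else 0) ≤ k′) (sym eq)
                      (subst (_≤ k′) (sym (+-identityʳ k)) k≤k′))

  δ-extend⁻ : ∀ {e k k′} (m : e ∈ es) → neg e ≡ true → k < k′ → k′ ≤ r →
              δ k′ (tgt e) ℚ.≤ wt e +ℚ δ k (src e)
  δ-extend⁻ {k = k} {k′} m eq k<k′ =
    δ-extend m (subst (λ b → k + (if b then 1 else 0) ≤ k′) (sym eq)
                      (subst (_≤ k′) (+-comm 1 k) k<k′))

  δ-antitone : ∀ {k} u → suc k ≤ r → δ (suc k) u ℚ.≤ δ k u
  δ-antitone {k} u 1+k≤r with proj₁ (isDelta k u (<⇒≤ 1+k≤r))
  ... | w , p , hp≤k , wp≡δ =
    subst (δ (suc k) u ℚ.≤_) wp≡δ (proj₂ (isDelta (suc k) u 1+k≤r) w p (m≤n⇒m≤1+n hp≤k))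

  δ₀≡0 : ∀ x → δ 0 x ≡ 0ℚ
  δ₀≡0 x with proj₁ (isDelta 0 x z≤n)
  ... | u , p , hp≤0 , wp≡δ =
    ℚₚ.≤-antisym (proj₂ (isDelta 0 x z≤n) x [] z≤n)
                 (subst (0ℚ ℚ.≤_) wp≡δ (weight-nonneg nonneg p hp≤0))

  δ₀≤δᵣ-outside-R : ∀ {v} → ¬ InR v → δ 0 v ℚ.≤ δ r v
  δ₀≤δᵣ-outside-R {v} v∉R = subst (ℚ._≤ δ r v) (sym (δ₀≡0 v)) (ℚₚ.≮⇒≥ v∉R)

  InR? : ∀ v → Dec (InR v)
  InR? v = δ r v ℚₚ.<? 0ℚ

  wH-nonneg : ∀ {u i v j} (e : HEdge (u , i) (v , j)) → isReturn e ≡ false → 0ℚ ℚ.≤ wH e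
  wH-nonneg (pos-RR j m eq _ _ j≤r) _ = p≤q⇒0≤q-p (δ-extend⁺ m eq ≤-refl j≤r)
  wH-nonneg (pos-RnR j m eq _ v∉R j≤r) _ =
    p≤q⇒0≤q-p (ℚₚ.≤-trans (δ₀≤δᵣ-outside-R v∉R) (δ-extend⁺ m eq j≤r ≤-refl))
  wH-nonneg (pos-nR m eq _) _ = p≤q⇒0≤q-p (δ-extend⁺ m eq ≤-refl z≤n)
  wH-nonneg (neg-RR j m eq _ _ j<r) _ = p≤q⇒0≤q-p (δ-extend⁻ m eq ≤-refl j<r)
  wH-nonneg (neg-RnR j m eq _ v∉R j<r) _ =
    p≤q⇒0≤q-p (ℚₚ.≤-trans (δ₀≤δᵣ-outside-R v∉R) (δ-extend⁻ m eq j<r ≤-refl))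
  wH-nonneg (neg-nRR m eq _ _) _ = p≤q⇒0≤q-p (δ-extend⁻ m eq ≤-refl r≥1)
  wH-nonneg (neg-nRnR m eq _ v∉R) _ =
    p≤q⇒0≤q-p (ℚₚ.≤-trans (δ₀≤δᵣ-outside-R v∉R) (δ-extend⁻ m eq r≥1 ≤-refl))
  wH-nonneg (self-up u j _ j<r) _ =
    p≤q⇒0≤q-p (subst (δ (suc j) u ℚ.≤_) (sym (ℚₚ.+-identityˡ (δ j u))) (δ-antitone u j<r))
  wH-nonneg (self-back _ _) ()

  hopsH≤returnEdges : ∀ {a b} (p : HWalk a b) → hopsH p ≤ returnEdges p
  hopsH≤returnEdges [] = z≤n
  hopsH≤returnEdges (_∷_ {u , i} {v , j} e p) with isReturn e in ret | wH e ℚₚ.<? 0ℚ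
  ... | true  | yes _ = s≤s (hopsH≤returnEdges p)
  ... | true  | no _  = m≤n⇒m≤1+n (hopsH≤returnEdges p)
  ... | false | yes wH<0 = ⊥-elim (ℚₚ.<-irrefl refl (ℚₚ.≤-<-trans (wH-nonneg e ret) wH<0))
  ... | false | no _  = hopsH≤returnEdges p

  record LiftedWalk (u : Fin n) (i : ℕ) (x : Fin n) (w : ℚ) (budget : ℕ) : Set where
    constructor lifted
    field
      layer       : ℕ
      valid       : InVH (x , layer)
      walk        : HWalk (u , i) (x , layer)
      baseWeight≡ : baseWeightH walk ≡ w
      cost≤       : r * returnEdges walk + layer ≤ budget

  layer-zero-outside-R : ∀ {u i} → InVH (u , i) → ¬ InR u → i ≡ 0
  layer-zero-outside-R (_ , inj₁ i≡0) _   = i≡0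
  layer-zero-outside-R (_ , inj₂ u∈R) u∉R = ⊥-elim (u∉R u∈R)

  liftHEdge : ∀ {u i x k b} (e : HEdge (u , i) (x , k)) → isReturn e ≡ false →
              InVH (x , k) → k ≤ b → LiftedWalk u i x (baseWt e) b
  liftHEdge {k = k} {b} e notReturn valid k≤b =
    lifted k valid (e ∷ []) (ℚₚ.+-identityʳ (baseWt e)) cost≤
    where
    cost≤ : r * returnEdges (e ∷ []) + k ≤ b
    cost≤ = subst (λ c → r * (if c then 1 else 0) + k ≤ b) (sym notReturn)
                  (subst (λ t → t + k ≤ b) (sym (*-zeroʳ r)) k≤b)

  prependReturn : ∀ {u x w b} → InR u → LiftedWalk u 0 x w b → LiftedWalk u r x w (r + b)
  prependReturn {u} {b = b} u∈R (lifted j valid p w≡ c) =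
    lifted j valid (self-back u u∈R ∷ p) (trans (ℚₚ.+-identityˡ _) w≡) cost≤
    where
    open ≤-Reasoning
    cost≤ : r * suc (returnEdges p) + j ≤ r + b
    cost≤ = begin
      r * suc (returnEdges p) + j   ≡⟨ cong (_+ j) (*-suc r (returnEdges p)) ⟩
      r + r * returnEdges p + j     ≡⟨ +-assoc r _ j ⟩
      r + (r * returnEdges p + j)   ≤⟨ +-monoʳ-≤ r c ⟩
      r + b                         ∎

  liftPosEdge : ∀ {e i} (m : e ∈ es) → neg e ≡ false → InVH (src e , i) →
                LiftedWalk (src e) i (tgt e) (wt e) (i + 0)
  liftPosEdge {e} {i} m eq valid@(i≤r , _) with InR? (src e) | InR? (tgt e)
  ... | yes u∈R | yes v∈R =
    liftHEdge (pos-RR i m eq u∈R v∈R i≤r) refl (i≤r , inj₂ v∈R) (m≤m+n i 0)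
  ... | yes u∈R | no v∉R =
    liftHEdge (pos-RnR i m eq u∈R v∉R i≤r) refl (z≤n , inj₁ refl) z≤n
  ... | no u∉R  | _ with layer-zero-outside-R valid u∉R
  ...   | refl = liftHEdge (pos-nR m eq u∉R) refl (z≤n , inj₁ refl) z≤n

  liftNegEdgeBelowTop : ∀ {e i} (m : e ∈ es) → neg e ≡ true → i < r → InVH (src e , i) →
                        LiftedWalk (src e) i (tgt e) (wt e) (i + 1)
  liftNegEdgeBelowTop {e} {i} m eq i<r valid with InR? (src e) | InR? (tgt e)
  ... | yes u∈R | yes v∈R =
    liftHEdge (neg-RR i m eq u∈R v∈R i<r) refl (i<r , inj₂ v∈R) (≤-reflexive (+-comm 1 i))
  ... | yes u∈R | no v∉R =
    liftHEdge (neg-RnR i m eq u∈R v∉R i<r) refl (z≤n , inj₁ refl) z≤n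
  ... | no u∉R | yes v∈R with layer-zero-outside-R valid u∉R
  ...   | refl = liftHEdge (neg-nRR m eq u∉R v∈R) refl (r≥1 , inj₂ v∈R) ≤-refl
  liftNegEdgeBelowTop m eq i<r valid | no u∉R | no v∉R with layer-zero-outside-R valid u∉R
  ...   | refl = liftHEdge (neg-nRnR m eq u∉R v∉R) refl (z≤n , inj₁ refl) z≤n

  liftNegEdge : ∀ {e i} (m : e ∈ es) → neg e ≡ true → InVH (src e , i) →
                LiftedWalk (src e) i (tgt e) (wt e) (i + 1)
  liftNegEdge {e} m eq valid@(i≤r , _) with InR? (src e)
  ... | no u∉R with layer-zero-outside-R valid u∉R
  ...   | refl = liftNegEdgeBelowTop m eq r≥1 valid
  liftNegEdge m eq valid@(i≤r , _) | yes u∈R with m≤n⇒m<n∨m≡n i≤r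
  ...   | inj₁ i<r  = liftNegEdgeBelowTop m eq i<r valid
  ...   | inj₂ refl = prependReturn u∈R (liftNegEdgeBelowTop m eq r≥1 (z≤n , inj₁ refl))

  liftEdge : ∀ {e i} (m : e ∈ es) → InVH (src e , i) →
             LiftedWalk (src e) i (tgt e) (wt e) (i + hops (m ∷ []))
  liftEdge {e} m valid with neg e in eq
  ... | false = liftPosEdge m eq valid
  ... | true  = liftNegEdge m eq valid

  liftWalk : ∀ {u i x} → InVH (u , i) → (q : Walk es u x) →
             LiftedWalk u i x (weight q) (i + hops q)
  liftWalk {i = i} valid [] =
    lifted i valid [] refl (≤-reflexive (trans (cong (_+ i) (*-zeroʳ r)) (sym (+-identityʳ i))))
  liftWalk {i = i} valid (m ∷ q) with liftEdge m valid
  ... | lifted k valid′ p₁ w₁≡ c₁ with liftWalk valid′ q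
  ... | lifted j valid″ p₂ w₂≡ c₂ =
    lifted j valid″ (p₁ ++ᴴ p₂) (trans (baseWeightH-++ p₁ p₂) (cong₂ _+ℚ_ w₁≡ w₂≡)) cost≤
    where
    open ≤-Reasoning
    R₁ = returnEdges p₁
    R₂ = returnEdges p₂
    cost≤ : r * returnEdges (p₁ ++ᴴ p₂) + j ≤ i + hops (m ∷ q)
    cost≤ = begin
      r * returnEdges (p₁ ++ᴴ p₂) + j   ≡⟨ cong (λ t → r * t + j) (returnEdges-++ p₁ p₂) ⟩
      r * (R₁ + R₂) + j                 ≡⟨ cong (_+ j) (*-distribˡ-+ r R₁ R₂) ⟩
      r * R₁ + r * R₂ + j               ≡⟨ +-assoc (r * R₁) _ j ⟩
      r * R₁ + (r * R₂ + j)             ≤⟨ +-monoʳ-≤ (r * R₁) c₂ ⟩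
      r * R₁ + (k + hops q)             ≡⟨ +-assoc (r * R₁) k _ ⟨
      r * R₁ + k + hops q               ≤⟨ +-monoˡ-≤ (hops q) c₁ ⟩
      i + hops (m ∷ []) + hops q        ≡⟨ +-assoc i _ _ ⟩
      i + (hops (m ∷ []) + hops q)      ≡⟨ cong (i +_) (hops-∷ m q) ⟨
      i + hops (m ∷ q)                  ∎

lemma7p3 : (n : ℕ) (es : List (Edge n)) → NonnegE⁺ es →
    (r : ℕ) → 1 ≤ r →
    (δ : ℕ → Fin n → ℚ) → IsDelta es r δ →
    (h : ℕ) (s v : Fin n) (p : Walk es s v) → hops p ≤ h →
    Σ ℕ λ j → Σ ℕ λ hH →
      HopReduction.InVH es r δ (v , j) ×
      Σ (HopReduction.HWalk es r δ (s , 0) (v , j)) λ pH →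
        HopReduction.hopsH es r δ pH ≤ hH ×
        HopReduction.weightH es r δ pH ≡ (weight p +ℚ δ 0 s) -ℚ δ j v ×
        r * hH + j ≤ h
lemma7p3 n es nonneg r r≥1 δ isDelta h s v p hops≤h
  with Lifting.liftWalk es nonneg r r≥1 δ isDelta (z≤n , inj₁ refl) p
... | Lifting.lifted j valid pH baseWeight≡ cost≤ =
  j , returnEdges pH , valid , pH , hopsH≤returnEdges pH ,
  trans (weightH-telescopes pH) (cong (λ w → w +ℚ δ 0 s -ℚ δ j v) baseWeight≡) ,
  ≤-trans cost≤ hops≤h
  where open HWalkProperties es r δ
        open Lifting es nonneg r r≥1 δ isDelta using (hopsH≤returnEdges)
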